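{- Let $d\ge 1$ be an integer and let $T$ be the complete binary tree of depth $d$. Then \[\frac{d-\log_2(d)-3-\log_2(3)}{2}\le \Phi_V(T)\le \lceil d/2\rceil .\]
   Context: The complete binary tree of depth $d$ is the rooted tree in which every vertex at distance less than $d$ from the root has exactly $2$ children, and the vertices at distance $d$ from the root are leaves. For a graph $G$ and $S\subseteq V(G)$, the vertex-border is $\delta(S)=\{v\in V(G)\setminus S : N(v)\cap S\neq\emptyset\}$. The vertex-isoperimetric parameter is $\Phi_V(G,s)=\min_{S\subseteq V(G),\,|S|=s}|\delta(S)|$, and the vertex-isoperimetric peak is $\Phi_V(G)=\max_{0\le s\le |V(G)|}\Phi_V(G,s)$. -}

module Defs where

open import Data.Nat using (ℕ; zero; suc; _+_; _*_; _∸_; _^_; _⊔_; _⊓_; _≡ᵇ_)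
open import Data.Bool using (Bool; true; false; _∧_; _∨_; not)
open import Data.Fin using (Fin; toℕ)
open import Data.Fin.Subset using (Subset; ∣_∣)
open import Data.Vec using (Vec; []; _∷_; lookup; tabulate)
open import Data.List using (List; []; _∷_; map; concatMap; foldr; filter; upTo)
open import Data.Bool.ListAction using (any)
open import Data.List.Base using (allFin)
open import Relation.Binary.PropositionalEquality using (_≡_)
open import Data.Nat.Properties using (_≟_)

Graph : ℕ → Set
Graph n = Fin n → Fin n → Bool

_∈ᵇ_ : ∀ {n} → Fin n → Subset n → Bool
v ∈ᵇ S = lookup S v

border : ∀ {n} → Graph n → Subset n → Subset n
border {n} G S = tabulate λ v → not (v ∈ᵇ S) ∧ any (λ u → (u ∈ᵇ S) ∧ G u v) (allFin n)

allSubsets : (n : ℕ) → List (Subset n)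
allSubsets zero = [] ∷ []
allSubsets (suc n) = concatMap (λ S → (true ∷ S) ∷ (false ∷ S) ∷ []) (allSubsets n)

minimumOr : ℕ → List ℕ → ℕ
minimumOr d [] = d
minimumOr d (x ∷ xs) = foldr _⊓_ x xs

maximum : List ℕ → ℕ
maximum = foldr _⊔_ 0

-- Φ_V(G, s) = min over S ⊆ V(G), |S| = s of |δ(S)|  (for s ≤ |V(G)| the list is nonempty).
PhiVs : ∀ {n} → Graph n → ℕ → ℕ
PhiVs {n} G s =
  minimumOr 0 (map (λ S → ∣ border G S ∣) (filter (λ S → ∣ S ∣ ≟ s) (allSubsets n)))

PhiV : ∀ {n} → Graph n → ℕ
PhiV {n} G = maximum (map (PhiVs G) (upTo (suc n)))

-- Complete binary tree of depth d, in heap numbering: vertices 0 … 2^(d+1) - 2,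
-- vertex i has children 2i+1 and 2i+2 (when these are vertices).
cbtSize : ℕ → ℕ
cbtSize d = 2 ^ (suc d) ∸ 1

isChild : ℕ → ℕ → Bool
isChild i j = (j ≡ᵇ (2 * i + 1)) ∨ (j ≡ᵇ (2 * i + 2))

completeBinaryTree : (d : ℕ) → Graph (cbtSize d)
completeBinaryTree d u v = isChild (toℕ u) (toℕ v) ∨ isChild (toℕ v) (toℕ u)

-- Lower bound: cut a vertex set S at its border. In every subtree the set is, up to corrections charged to
-- border vertices, either empty or the whole subtree, so ∣S∣ + m + P = z + n where P and z together are sums
-- of at most ∣δ(S)∣ + 1 powers of two and m, n ≤ 2∣δ(S)∣ + 1. Adding a power of two to a number changes the
-- number of transitions 0↔1 in its binary expansion by at most 2, and adding a number c ≤ 2 ^ L changes it by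
-- at most L + 2. The size 1010…₂ with d + 1 digits has d + 1 transitions, which forces
-- d ≤ 2∣δ(S)∣ + 3 + log₂ (3d).
-- Upper bound: sets of every size are built recursively, a full left subtree next to a recursively built right
-- one; a new border vertex is needed only every second level, because a root outside the set whose parent and
-- children are outside is not on the border.
module Submission where

open import Data.Bool using (Bool; true; false; not; _∧_; _∨_; _xor_; if_then_else_; T)
open import Data.Bool.Properties using (T-∧; T-∨)
open import Data.Bool.ListAction using (any)
open import Data.Empty using (⊥-elim)
open import Data.Fin using (Fin; toℕ; fromℕ<)
open import Data.Fin.Properties using (toℕ<n; toℕ-fromℕ<)
open import Data.Fin.Subset using (Subset; ∣_∣)
open import Data.List using (List; []; _∷_; _∷ʳ_; reverse; map; filter; upTo; allFin)
open import Data.List.Properties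
  using (unfold-reverse; reverse-involutive; foldr-preservesᵒ; foldr-preservesᵇ)
open import Data.List.Membership.Propositional using (_∈_; lose)
open import Data.List.Membership.Propositional.Properties
  using (∈-allFin; foldr-selective; ∈-concatMap⁺; ∈-filter⁺; ∈-filter⁻; ∈-map⁺; ∈-map⁻;
         ∈-upTo⁺; ∈-upTo⁻)
open import Data.List.Relation.Unary.All as All using (All)
open import Data.List.Relation.Unary.Any as Any using (Any; here; there; satisfied)
open import Data.List.Relation.Unary.Any.Properties using (any⁺; any⁻)
open import Data.Nat
  using (ℕ; zero; suc; _+_; _*_; _∸_; _^_; _≤_; _<_; z≤n; s≤s; ⌊_/2⌋; ⌈_/2⌉; ∣_-_∣;
         _≤?_; _<?_; _<ᵇ_; _≡ᵇ_; _⊓_; _⊔_)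
open import Data.Nat.Induction using (<-rec)
open import Data.Nat.Logarithm using (⌊log₂_⌋; ⌊log₂⌋-mono-≤; ⌊log₂[2^n]⌋≡n)
open import Data.Nat.Properties
open import Data.Nat.Tactic.RingSolver using (solve-∀)
open import Algebra.Properties.CommutativeSemigroup +-commutativeSemigroup
  using (interchange; x∙yz≈y∙xz; x∙yz≈yx∙z; x∙yz≈xz∙y; xy∙z≈xz∙y)
open import Data.Product using (Σ; ∃; _×_; _,_; proj₂)
open import Data.Sum using (_⊎_; inj₁; inj₂; [_,_]′)
open import Data.Unit using (tt)
open import Data.Vec using (tabulate) renaming (_∷_ to _∷ᵛ_; [] to []ᵛ)
open import Data.Vec.Properties using (lookup∘tabulate; tabulate-cong)
open import Function using (_∘_)
open import Function.Bundles using (Equivalence)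
open import Relation.Binary.PropositionalEquality
open import Relation.Nullary using (yes; no)

open import Defs

bit : Bool → ℕ
bit false = 0
bit true  = 1

bit≤1 : ∀ b → bit b ≤ 1
bit≤1 false = z≤n
bit≤1 true  = ≤-refl

∣bit-bit∣≤1 : ∀ a b → ∣ bit a - bit b ∣ ≤ 1
∣bit-bit∣≤1 false false = z≤n
∣bit-bit∣≤1 false true  = ≤-refl
∣bit-bit∣≤1 true  false = ≤-refl
∣bit-bit∣≤1 true  true  = z≤n

bit[not-b-xor-b]≡1 : ∀ b → bit (not b xor b) ≡ 1
bit[not-b-xor-b]≡1 false = refl
bit[not-b-xor-b]≡1 true  = refl

∣m+n-o+p∣≤∣m-o∣+∣n-p∣ : ∀ m n o p → ∣ m + n - o + p ∣ ≤ ∣ m - o ∣ + ∣ n - p ∣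
∣m+n-o+p∣≤∣m-o∣+∣n-p∣ m n o p = begin
  ∣ m + n - o + p ∣                   ≤⟨ ∣-∣-triangle (m + n) (m + p) (o + p) ⟩
  ∣ m + n - m + p ∣ + ∣ m + p - o + p ∣ ≡⟨ cong₂ _+_ (∣m+n-m+o∣≡∣n-o∣ m n p) ∣m+p-o+p∣≡∣m-o∣ ⟩
  ∣ n - p ∣ + ∣ m - o ∣                 ≡⟨ +-comm ∣ n - p ∣ ∣ m - o ∣ ⟩
  ∣ m - o ∣ + ∣ n - p ∣                 ∎
  where
  open ≤-Reasoning
  ∣m+p-o+p∣≡∣m-o∣ : ∣ m + p - o + p ∣ ≡ ∣ m - o ∣
  ∣m+p-o+p∣≡∣m-o∣ = trans (cong₂ ∣_-_∣ (+-comm m p) (+-comm o p)) (∣m+n-m+o∣≡∣n-o∣ p m o)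

∣bit+m-bit+n∣≤1+∣m-n∣ : ∀ a b m n → ∣ bit a + m - bit b + n ∣ ≤ suc ∣ m - n ∣
∣bit+m-bit+n∣≤1+∣m-n∣ a b m n =
  ≤-trans (∣m+n-o+p∣≤∣m-o∣+∣n-p∣ (bit a) m (bit b) n) (+-monoˡ-≤ ∣ m - n ∣ (∣bit-bit∣≤1 a b))

∣m-n∣≤k⇒m≤n+k : ∀ m n {k} → ∣ m - n ∣ ≤ k → m ≤ n + k
∣m-n∣≤k⇒m≤n+k m n d≤k = ≤-trans (m≤n+∣m-n∣ m n) (+-monoʳ-≤ n d≤k)

∣m-n∣≤k⇒n≤m+k : ∀ m n {k} → ∣ m - n ∣ ≤ k → n ≤ m + k
∣m-n∣≤k⇒n≤m+k m n d≤k = ≤-trans (m≤n+∣n-m∣ n m) (+-monoʳ-≤ m d≤k)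

lsb : ℕ → Bool
lsb 0             = false
lsb 1             = true
lsb (suc (suc n)) = lsb n

double : ℕ → ℕ
double zero    = zero
double (suc n) = suc (suc (double n))

double≡2* : ∀ n → double n ≡ 2 * n
double≡2* zero    = refl
double≡2* (suc n) = cong suc (trans (cong suc (double≡2* n)) (sym (+-suc n (n + 0))))

double-distrib-+ : ∀ m n → double (m + n) ≡ double m + double n
double-distrib-+ zero    n = refl
double-distrib-+ (suc m) n = cong (suc ∘ suc) (double-distrib-+ m n)

lsb[bit+double] : ∀ b y → lsb (bit b + double y) ≡ b
lsb[bit+double] false zero    = refl
lsb[bit+double] true  zero    = refl
lsb[bit+double] false (suc y) = lsb[bit+double] false y
lsb[bit+double] true  (suc y) = lsb[bit+double] true y

⌊bit+double/2⌋≡ : ∀ b y → ⌊ bit b + double y /2⌋ ≡ y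
⌊bit+double/2⌋≡ false zero    = refl
⌊bit+double/2⌋≡ true  zero    = refl
⌊bit+double/2⌋≡ false (suc y) = cong suc (⌊bit+double/2⌋≡ false y)
⌊bit+double/2⌋≡ true  (suc y) = cong suc (⌊bit+double/2⌋≡ true y)

bit[lsb]+double[⌊/2⌋]≡ : ∀ x → bit (lsb x) + double ⌊ x /2⌋ ≡ x
bit[lsb]+double[⌊/2⌋]≡ zero          = refl
bit[lsb]+double[⌊/2⌋]≡ (suc zero)    = refl
bit[lsb]+double[⌊/2⌋]≡ (suc (suc x)) =
  trans (+-suc (bit (lsb x)) (suc (double ⌊ x /2⌋)))
        (cong suc (trans (+-suc (bit (lsb x)) (double ⌊ x /2⌋)) (cong suc (bit[lsb]+double[⌊/2⌋]≡ x))))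

lsb-suc : ∀ y → lsb (suc y) ≡ not (lsb y)
lsb-suc zero          = refl
lsb-suc (suc zero)    = refl
lsb-suc (suc (suc y)) = lsb-suc y

binaryInduction : ∀ {ℓ} (P : ℕ → Set ℓ) → P 0 →
                  (∀ b y → P y → P (bit b + double y)) → ∀ x → P x
binaryInduction P P0 P[bit+double] = <-rec P go
  where
  go : ∀ x → (∀ {y} → y < x → P y) → P x
  go zero    _   = P0
  go (suc x) rec = subst P (bit[lsb]+double[⌊/2⌋]≡ (suc x))
    (P[bit+double] (lsb (suc x)) ⌊ suc x /2⌋ (rec (⌊n/2⌋<n x)))

-- The number of transitions in the binary expansion

transitionsWithin : ℕ → ℕ → ℕ
transitionsWithin zero    x = 0
transitionsWithin (suc k) x = bit (lsb x xor lsb ⌊ x /2⌋) + transitionsWithin k ⌊ x /2⌋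

-- x halves to 0 in at most x steps, so x is enough fuel.
transitions : ℕ → ℕ
transitions x = transitionsWithin x x

transitionsWithin-0 : ∀ k → transitionsWithin k 0 ≡ 0
transitionsWithin-0 zero    = refl
transitionsWithin-0 (suc k) = transitionsWithin-0 k

transitionsWithin-stable : ∀ k l x → x ≤ k → x ≤ l → transitionsWithin k x ≡ transitionsWithin l x
transitionsWithin-stable zero    l       zero z≤n _   = sym (transitionsWithin-0 l)
transitionsWithin-stable (suc k) zero    zero _   z≤n = transitionsWithin-0 (suc k)
transitionsWithin-stable (suc k) (suc l) x    x≤k x≤l =
  cong (bit (lsb x xor lsb ⌊ x /2⌋) +_)
       (transitionsWithin-stable k l ⌊ x /2⌋ (⌊x/2⌋≤ x≤k) (⌊x/2⌋≤ x≤l))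
  where
  ⌊x/2⌋≤ : ∀ {x m} → x ≤ suc m → ⌊ x /2⌋ ≤ m
  ⌊x/2⌋≤ {x} {m} x≤1+m = ≤-pred (≤-trans (s≤s (⌊n/2⌋-mono x≤1+m)) (⌊n/2⌋<n m))

transitions-unfold : ∀ x → transitions x ≡ bit (lsb x xor lsb ⌊ x /2⌋) + transitions ⌊ x /2⌋
transitions-unfold zero    = refl
transitions-unfold (suc x) = cong (bit (lsb (suc x) xor lsb ⌊ suc x /2⌋) +_)
  (transitionsWithin-stable x ⌊ suc x /2⌋ ⌊ suc x /2⌋ (≤-pred (⌊n/2⌋<n x)) ≤-refl)

transitions[bit+double] : ∀ b y → transitions (bit b + double y) ≡ bit (b xor lsb y) + transitions y
transitions[bit+double] b y = trans (transitions-unfold (bit b + double y))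
  (cong₂ (λ c z → bit (c xor lsb z) + transitions z) (lsb[bit+double] b y) (⌊bit+double/2⌋≡ b y))

∣transitions-bit+double∣≤ : ∀ b c y z →
  ∣ transitions (bit c + double z) - transitions (bit b + double y) ∣ ≤ suc ∣ transitions z - transitions y ∣
∣transitions-bit+double∣≤ b c y z =
  subst (_≤ suc ∣ transitions z - transitions y ∣)
        (sym (cong₂ ∣_-_∣ (transitions[bit+double] c z) (transitions[bit+double] b y)))
        (∣bit+m-bit+n∣≤1+∣m-n∣ (c xor lsb z) (b xor lsb y) (transitions z) (transitions y))

∣transitions[1+x]-transitions[x]∣≤1 : ∀ x → ∣ transitions (suc x) - transitions x ∣ ≤ 1
∣transitions[1+x]-transitions[x]∣≤1 =
  binaryInduction (λ x → ∣ transitions (suc x) - transitions x ∣ ≤ 1) ≤-refl step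
  where
  open ≤-Reasoning
  step : ∀ b y → ∣ transitions (suc y) - transitions y ∣ ≤ 1 →
         ∣ transitions (suc (bit b + double y)) - transitions (bit b + double y) ∣ ≤ 1
  step false y _ = begin
    ∣ transitions (bit true + double y) - transitions (bit false + double y) ∣
      ≤⟨ ∣transitions-bit+double∣≤ false true y y ⟩
    suc ∣ transitions y - transitions y ∣
      ≡⟨ cong suc (∣n-n∣≡0 (transitions y)) ⟩
    1 ∎
  step true y ih = begin
    ∣ transitions (bit false + double (suc y)) - transitions (bit true + double y) ∣
      ≡⟨ cong₂ ∣_-_∣ (transitions[bit+double] false (suc y)) (transitions[bit+double] true y) ⟩
    ∣ bit (lsb (suc y)) + transitions (suc y) - bit (not (lsb y)) + transitions y ∣
      ≡⟨ cong (λ b → ∣ bit b + transitions (suc y) - bit (not (lsb y)) + transitions y ∣) (lsb-suc y) ⟩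
    ∣ bit (not (lsb y)) + transitions (suc y) - bit (not (lsb y)) + transitions y ∣
      ≡⟨ ∣m+n-m+o∣≡∣n-o∣ (bit (not (lsb y))) (transitions (suc y)) (transitions y) ⟩
    ∣ transitions (suc y) - transitions y ∣
      ≤⟨ ih ⟩
    1 ∎

bit+double+double : ∀ b y z → bit b + double y + double z ≡ bit b + double (y + z)
bit+double+double b y z =
  trans (+-assoc (bit b) (double y) (double z)) (cong (bit b +_) (sym (double-distrib-+ y z)))

lsb[x+double] : ∀ x z → lsb (x + double z) ≡ lsb x
lsb[x+double] x zero    = cong lsb (+-identityʳ x)
lsb[x+double] x (suc z) =
  trans (cong lsb (trans (+-suc x (suc (double z))) (cong suc (+-suc x (double z)))))
        (lsb[x+double] x z)

2^[1+e]≡double[2^e] : ∀ e → 2 ^ suc e ≡ double (2 ^ e)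
2^[1+e]≡double[2^e] e = sym (double≡2* (2 ^ e))

∣transitions[x+2^e]-transitions[x]∣≤2 : ∀ e x → ∣ transitions (x + 2 ^ e) - transitions x ∣ ≤ 2
∣transitions[x+2^e]-transitions[x]∣≤2 zero x =
  subst (λ x+1 → ∣ transitions x+1 - transitions x ∣ ≤ 2) (sym (+-comm x 1))
        (≤-trans (∣transitions[1+x]-transitions[x]∣≤1 x) (n≤1+n 1))
∣transitions[x+2^e]-transitions[x]∣≤2 (suc e) x =
  subst₂ (λ x′ x+2^e → ∣ transitions x+2^e - transitions x′ ∣ ≤ 2) x≡ x+2^e≡ (halved e)
  where
  b = lsb x
  y = ⌊ x /2⌋
  x≡ : bit b + double y ≡ x
  x≡ = bit[lsb]+double[⌊/2⌋]≡ x
  x+2^e≡ : bit b + double (y + 2 ^ e) ≡ x + 2 ^ suc e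
  x+2^e≡ = sym (trans (cong₂ _+_ (sym x≡) (2^[1+e]≡double[2^e] e)) (bit+double+double b y (2 ^ e)))
  halved : ∀ e → ∣ transitions (bit b + double (y + 2 ^ e)) - transitions (bit b + double y) ∣ ≤ 2
  halved zero = ≤-trans (∣transitions-bit+double∣≤ b b y (y + 1))
    (s≤s (subst (λ y+1 → ∣ transitions y+1 - transitions y ∣ ≤ 1) (+-comm 1 y)
                (∣transitions[1+x]-transitions[x]∣≤1 y)))
  halved (suc e) = begin
    ∣ transitions (bit b + double (y + 2 ^ suc e)) - transitions (bit b + double y) ∣
      ≡⟨ cong₂ ∣_-_∣ (transitions[bit+double] b (y + 2 ^ suc e)) (transitions[bit+double] b y) ⟩
    ∣ bit (b xor lsb (y + 2 ^ suc e)) + transitions (y + 2 ^ suc e) - bit (b xor lsb y) + transitions y ∣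
      ≡⟨ cong (λ l → ∣ bit (b xor l) + transitions (y + 2 ^ suc e) - bit (b xor lsb y) + transitions y ∣)
              (trans (cong (λ p → lsb (y + p)) (2^[1+e]≡double[2^e] e)) (lsb[x+double] y (2 ^ e))) ⟩
    ∣ bit (b xor lsb y) + transitions (y + 2 ^ suc e) - bit (b xor lsb y) + transitions y ∣
      ≡⟨ ∣m+n-m+o∣≡∣n-o∣ (bit (b xor lsb y)) (transitions (y + 2 ^ suc e)) (transitions y) ⟩
    ∣ transitions (y + 2 ^ suc e) - transitions y ∣
      ≤⟨ ∣transitions[x+2^e]-transitions[x]∣≤2 (suc e) y ⟩
    2 ∎
    where open ≤-Reasoning

∣transitions[x+c]-transitions[x]∣≤L+2 : ∀ L x c → c ≤ 2 ^ L → ∣ transitions (x + c) - transitions x ∣ ≤ L + 2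
∣transitions[x+c]-transitions[x]∣≤L+2 zero x zero _ =
  ≤-trans (≤-reflexive (trans (cong (λ x+0 → ∣ transitions x+0 - transitions x ∣) (+-identityʳ x))
                              (∣n-n∣≡0 (transitions x))))
          z≤n
∣transitions[x+c]-transitions[x]∣≤L+2 zero x (suc zero) _ = ∣transitions[x+2^e]-transitions[x]∣≤2 0 x
∣transitions[x+c]-transitions[x]∣≤L+2 zero x (suc (suc c)) (s≤s ())
∣transitions[x+c]-transitions[x]∣≤L+2 (suc L) x c c≤2^[1+L] =
  subst₂ (λ x′ x+c → ∣ transitions x+c - transitions x′ ∣ ≤ suc L + 2) x≡ x+c≡
    (≤-trans (∣transitions-bit+double∣≤ b r y (y + z))
             (s≤s (∣transitions[x+c]-transitions[x]∣≤L+2 L y z z≤2^L)))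
  where
  b = lsb x
  y = ⌊ x /2⌋
  m = bit b + c
  r = lsb m
  z = ⌊ m /2⌋
  x≡ : bit b + double y ≡ x
  x≡ = bit[lsb]+double[⌊/2⌋]≡ x
  x+c≡ : bit r + double (y + z) ≡ x + c
  x+c≡ = begin
    bit r + double (y + z)       ≡⟨ cong (bit r +_) (double-distrib-+ y z) ⟩
    bit r + (double y + double z) ≡⟨ x∙yz≈y∙xz (bit r) (double y) (double z) ⟩
    double y + (bit r + double z) ≡⟨ cong (double y +_) (bit[lsb]+double[⌊/2⌋]≡ m) ⟩
    double y + (bit b + c)        ≡⟨ x∙yz≈yx∙z (double y) (bit b) c ⟩
    bit b + double y + c          ≡⟨ cong (_+ c) x≡ ⟩
    x + c                         ∎
    where open ≡-Reasoning
  z≤2^L : z ≤ 2 ^ L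
  z≤2^L = begin
    ⌊ bit b + c /2⌋                  ≤⟨ ⌊n/2⌋-mono (+-mono-≤ (bit≤1 b) c≤2^[1+L]) ⟩
    ⌊ bit true + 2 ^ suc L /2⌋       ≡⟨ cong (λ p → ⌊ bit true + p /2⌋) (2^[1+e]≡double[2^e] L) ⟩
    ⌊ bit true + double (2 ^ L) /2⌋  ≡⟨ ⌊bit+double/2⌋≡ true (2 ^ L) ⟩
    2 ^ L                            ∎
    where open ≤-Reasoning

infixr 5 _∷ₚ_

data PowSum : ℕ → ℕ → Set where
  []ₚ  : PowSum 0 0
  _∷ₚ_ : ∀ {k N} e → PowSum k N → PowSum (suc k) (2 ^ e + N)

PowSum-+ : ∀ {k N l M} → PowSum k N → PowSum l M → PowSum (k + l) (N + M)
PowSum-+ []ₚ                       ps = ps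
PowSum-+ {M = M} (_∷ₚ_ {N = N} e ps) qs =
  subst (PowSum _) (sym (+-assoc (2 ^ e) N M)) (e ∷ₚ PowSum-+ ps qs)

∣transitions[x+N]-transitions[x]∣≤2k : ∀ {k N} → PowSum k N → ∀ x →
                                       ∣ transitions (x + N) - transitions x ∣ ≤ 2 * k
∣transitions[x+N]-transitions[x]∣≤2k []ₚ x =
  ≤-reflexive (trans (cong (λ x+0 → ∣ transitions x+0 - transitions x ∣) (+-identityʳ x)) (∣n-n∣≡0 (transitions x)))
∣transitions[x+N]-transitions[x]∣≤2k {suc k} (_∷ₚ_ {N = N} e ps) x = begin
  ∣ transitions (x + (2 ^ e + N)) - transitions x ∣
    ≡⟨ cong (λ u → ∣ transitions u - transitions x ∣) (sym (+-assoc x (2 ^ e) N)) ⟩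
  ∣ transitions (x + 2 ^ e + N) - transitions x ∣
    ≤⟨ ∣-∣-triangle (transitions (x + 2 ^ e + N)) (transitions (x + 2 ^ e)) (transitions x) ⟩
  ∣ transitions (x + 2 ^ e + N) - transitions (x + 2 ^ e) ∣ + ∣ transitions (x + 2 ^ e) - transitions x ∣
    ≤⟨ +-mono-≤ (∣transitions[x+N]-transitions[x]∣≤2k ps (x + 2 ^ e))
                (∣transitions[x+2^e]-transitions[x]∣≤2 e x) ⟩
  2 * k + 2
    ≡⟨ trans (+-comm (2 * k) 2) (sym (*-suc 2 k)) ⟩
  2 * suc k ∎
  where open ≤-Reasoning

-- 1, 10, 101, 1010, … in binary: d + 1 digits and d + 1 transitions.
alternating : ℕ → ℕ
alternating zero    = 1
alternating (suc d) = bit (not (lsb (alternating d))) + double (alternating d)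

transitions[alternating] : ∀ d → transitions (alternating d) ≡ suc d
transitions[alternating] zero    = refl
transitions[alternating] (suc d) =
  trans (transitions[bit+double] (not l) (alternating d))
        (cong₂ _+_ (bit[not-b-xor-b]≡1 l) (transitions[alternating] d))
  where l = lsb (alternating d)

alternating<2^[1+d] : ∀ d → alternating d < 2 ^ suc d
alternating<2^[1+d] zero    = s≤s (s≤s z≤n)
alternating<2^[1+d] (suc d) = begin-strict
  bit (not (lsb a)) + double a ≤⟨ +-monoˡ-≤ (double a) (bit≤1 (not (lsb a))) ⟩
  1 + double a                 <⟨ n<1+n (1 + double a) ⟩
  double (suc a)               ≡⟨ double≡2* (suc a) ⟩
  2 * suc a                    ≤⟨ *-monoʳ-≤ 2 (alternating<2^[1+d] d) ⟩
  2 ^ suc (suc d)              ∎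
  where
  open ≤-Reasoning
  a = alternating d

data Dir : Set where
  left right : Dir

-- A vertex set of the infinite binary tree, vertices being root paths; in a tree of height h only
-- the paths of length < h count.
TreeSet : Set
TreeSet = List Dir → Bool

leftSubtree rightSubtree : TreeSet → TreeSet
leftSubtree  t q = t (left ∷ q)
rightSubtree t q = t (right ∷ q)

root∈ : ℕ → TreeSet → Bool
root∈ zero    t = false
root∈ (suc h) t = t []

count : ℕ → TreeSet → ℕ
count zero    t = 0
count (suc h) t = bit (t []) + count h (leftSubtree t) + count h (rightSubtree t)

onBorder : (p a aₗ aᵣ : Bool) → Bool
onBorder p a aₗ aᵣ = not a ∧ (p ∨ aₗ ∨ aᵣ)

-- p says whether the parent of the root is in the set.
borderCount : ℕ → TreeSet → Bool → ℕ
borderCount zero    t p = 0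
borderCount (suc h) t p =
  bit (onBorder p (t []) (root∈ h (leftSubtree t)) (root∈ h (rightSubtree t)))
    + borderCount h (leftSubtree t) (t []) + borderCount h (rightSubtree t) (t [])

-- The size of a set is a signed sum of few powers of two

record Corrections (b : ℕ) : Set where
  constructor mkCorrections
  field
    k⁺ k⁻ P⁺ P⁻ u⁺ u⁻ : ℕ
    powSum⁺ : PowSum k⁺ P⁺
    powSum⁻ : PowSum k⁻ P⁻
    k⁺+k⁻≤b : k⁺ + k⁻ ≤ b
    u⁻≤2b   : u⁻ ≤ 2 * b
    u⁺≤b    : u⁺ ≤ b

open Corrections

noCorrections : Corrections 0
noCorrections = record
  { k⁺ = 0 ; k⁻ = 0 ; P⁺ = 0 ; P⁻ = 0 ; u⁺ = 0 ; u⁻ = 0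
  ; powSum⁺ = []ₚ ; powSum⁻ = []ₚ ; k⁺+k⁻≤b = z≤n ; u⁻≤2b = z≤n ; u⁺≤b = z≤n }

infixl 6 _⊕_

_⊕_ : ∀ {b c} → Corrections b → Corrections c → Corrections (b + c)
_⊕_ {b} {c} C D = record
  { k⁺ = k⁺ C + k⁺ D ; k⁻ = k⁻ C + k⁻ D ; P⁺ = P⁺ C + P⁺ D ; P⁻ = P⁻ C + P⁻ D
  ; u⁺ = u⁺ C + u⁺ D ; u⁻ = u⁻ C + u⁻ D
  ; powSum⁺ = PowSum-+ (powSum⁺ C) (powSum⁺ D)
  ; powSum⁻ = PowSum-+ (powSum⁻ C) (powSum⁻ D)
  ; k⁺+k⁻≤b = ≤-trans (≤-reflexive (interchange (k⁺ C) (k⁺ D) (k⁻ C) (k⁻ D)))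
                      (+-mono-≤ (k⁺+k⁻≤b C) (k⁺+k⁻≤b D))
  ; u⁻≤2b   = ≤-trans (+-mono-≤ (u⁻≤2b C) (u⁻≤2b D)) (≤-reflexive (sym (*-distribˡ-+ 2 b c)))
  ; u⁺≤b    = +-mono-≤ (u⁺≤b C) (u⁺≤b D)
  }

-- c vertices, root status a and parent status p in height h: up to the corrections, a set whose root or
-- root's parent lies in it is the whole subtree (2 ^ h − 1 vertices), and any other set is empty.
Balanced : ∀ {b} (h c : ℕ) (p a : Bool) → Corrections b → Set
Balanced h c p a C =
  c + bit (not p ∧ a) + bit p + u⁻ C + P⁻ C ≡ (if p ∨ a then 2 ^ h else 0) + P⁺ C + u⁺ C

-- How the leading terms of the two subtrees of height h (H = 2 ^ h) and of the root itself combine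
-- into the leading term of the whole tree.
record RootCorrection (H : ℕ) (p a aₗ aᵣ : Bool) : Set where
  constructor mkRootCorrection
  field
    correction : Corrections (bit (onBorder p a aₗ aᵣ))
    unitBalance  : bit a + bit (not p ∧ a) + bit p + u⁻ correction
                     ≡ u⁺ correction + (bit (not a ∧ aₗ) + bit a) + (bit (not a ∧ aᵣ) + bit a)
    powerBalance : P⁻ correction + ((if a ∨ aₗ then H else 0) + (if a ∨ aᵣ then H else 0))
                     ≡ P⁺ correction + (if p ∨ a then H + H else 0)

excess : ∀ {k P} u⁻ → PowSum k P → k ≤ 1 → u⁻ ≤ 2 → Corrections 1
excess {k} {P} u⁻ ps k≤1 u⁻≤2 =
  mkCorrections k 0 P 0 0 u⁻ ps []ₚ (≤-trans (≤-reflexive (+-identityʳ k)) k≤1) u⁻≤2 z≤n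

deficit : ∀ {k P} u⁺ → PowSum k P → k ≤ 1 → u⁺ ≤ 1 → Corrections 1
deficit {k} {P} u⁺ ps k≤1 u⁺≤1 = mkCorrections 0 k 0 P u⁺ 0 []ₚ ps k≤1 z≤n u⁺≤1

module _ (e : ℕ) {H : ℕ} (2^e≡H : 2 ^ e ≡ H) where

  private
    H-powSum : PowSum 1 H
    H-powSum = subst (PowSum 1) (trans (+-identityʳ (2 ^ e)) 2^e≡H) (e ∷ₚ []ₚ)

    H+H-powSum : PowSum 1 (H + H)
    H+H-powSum = subst (PowSum 1) (trans (+-identityʳ (2 ^ suc e)) 2*2^e≡H+H) (suc e ∷ₚ []ₚ)
      where
      2*2^e≡H+H : 2 * 2 ^ e ≡ H + H
      2*2^e≡H+H = trans (cong (2 ^ e +_) (+-identityʳ (2 ^ e))) (cong₂ _+_ 2^e≡H 2^e≡H)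

  -- A root on the border pays for at most one power of two and two units.
  rootCorrection : ∀ p a aₗ aᵣ → RootCorrection H p a aₗ aᵣ
  rootCorrection true  true  _     _     = mkRootCorrection noCorrections refl refl
  rootCorrection false true  _     _     = mkRootCorrection noCorrections refl refl
  rootCorrection false false false false = mkRootCorrection noCorrections refl refl
  rootCorrection false false true  false = mkRootCorrection (excess 1 H-powSum ≤-refl (s≤s z≤n)) refl refl
  rootCorrection false false false true  = mkRootCorrection (excess 1 H-powSum ≤-refl (s≤s z≤n)) refl (sym (+-identityʳ H))
  rootCorrection false false true  true  = mkRootCorrection (excess 2 H+H-powSum ≤-refl ≤-refl) refl (sym (+-identityʳ (H + H)))
  rootCorrection true  false false false = mkRootCorrection (deficit 1 H+H-powSum ≤-refl ≤-refl) refl (+-identityʳ (H + H))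
  rootCorrection true  false true  false = mkRootCorrection (deficit 0 H-powSum ≤-refl z≤n) refl (cong (H +_) (+-identityʳ H))
  rootCorrection true  false false true  = mkRootCorrection (deficit 0 H-powSum ≤-refl z≤n) refl refl
  rootCorrection true  false true  true  = mkRootCorrection (excess 1 []ₚ z≤n (s≤s z≤n)) refl refl

balance-sum : ∀ A cₗ cᵣ y q u₀ uₗ uᵣ N₀ Nₗ Nᵣ M₀ Mₗ Mᵣ v₀ vₗ vᵣ xₗ xᵣ Tₗ Tᵣ T →
  cₗ + xₗ + A + uₗ + Nₗ ≡ Tₗ + Mₗ + vₗ →
  cᵣ + xᵣ + A + uᵣ + Nᵣ ≡ Tᵣ + Mᵣ + vᵣ →
  A + y + q + u₀ ≡ v₀ + (xₗ + A) + (xᵣ + A) →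
  N₀ + (Tₗ + Tᵣ) ≡ M₀ + T →
  A + cₗ + cᵣ + y + q + (u₀ + uₗ + uᵣ) + (N₀ + Nₗ + Nᵣ) ≡ T + (M₀ + Mₗ + Mᵣ) + (v₀ + vₗ + vᵣ)
balance-sum A cₗ cᵣ y q u₀ uₗ uᵣ N₀ Nₗ Nᵣ M₀ Mₗ Mᵣ v₀ vₗ vᵣ xₗ xᵣ Tₗ Tᵣ T eₗ eᵣ units powers =
  +-cancelʳ-≡ (xₗ + xᵣ + A + A + Tₗ + Tᵣ) _ _ (begin
    A + cₗ + cᵣ + y + q + (u₀ + uₗ + uᵣ) + (N₀ + Nₗ + Nᵣ) + (xₗ + xᵣ + A + A + Tₗ + Tᵣ)
      ≡⟨ regroupˡ A cₗ cᵣ y q u₀ uₗ uᵣ N₀ Nₗ Nᵣ xₗ xᵣ Tₗ Tᵣ ⟩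
    (cₗ + xₗ + A + uₗ + Nₗ) + (cᵣ + xᵣ + A + uᵣ + Nᵣ) + (A + y + q + u₀) + (N₀ + (Tₗ + Tᵣ))
      ≡⟨ cong₂ _+_ (cong₂ _+_ (cong₂ _+_ eₗ eᵣ) units) powers ⟩
    (Tₗ + Mₗ + vₗ) + (Tᵣ + Mᵣ + vᵣ) + (v₀ + (xₗ + A) + (xᵣ + A)) + (M₀ + T)
      ≡⟨ regroupʳ A M₀ Mₗ Mᵣ v₀ vₗ vᵣ xₗ xᵣ Tₗ Tᵣ T ⟩
    T + (M₀ + Mₗ + Mᵣ) + (v₀ + vₗ + vᵣ) + (xₗ + xᵣ + A + A + Tₗ + Tᵣ) ∎)
  where
  open ≡-Reasoning
  regroupˡ : ∀ A cₗ cᵣ y q u₀ uₗ uᵣ N₀ Nₗ Nᵣ xₗ xᵣ Tₗ Tᵣ →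
    A + cₗ + cᵣ + y + q + (u₀ + uₗ + uᵣ) + (N₀ + Nₗ + Nᵣ) + (xₗ + xᵣ + A + A + Tₗ + Tᵣ)
      ≡ (cₗ + xₗ + A + uₗ + Nₗ) + (cᵣ + xᵣ + A + uᵣ + Nᵣ) + (A + y + q + u₀) + (N₀ + (Tₗ + Tᵣ))
  regroupˡ = solve-∀
  regroupʳ : ∀ A M₀ Mₗ Mᵣ v₀ vₗ vᵣ xₗ xᵣ Tₗ Tᵣ T →
    (Tₗ + Mₗ + vₗ) + (Tᵣ + Mᵣ + vᵣ) + (v₀ + (xₗ + A) + (xᵣ + A)) + (M₀ + T)
      ≡ T + (M₀ + Mₗ + Mᵣ) + (v₀ + vₗ + vᵣ) + (xₗ + xᵣ + A + A + Tₗ + Tᵣ)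
  regroupʳ = solve-∀

record Decomposition (h c b : ℕ) (p a : Bool) : Set where
  constructor _,_
  field
    corrections : Corrections b
    balanced    : Balanced h c p a corrections

decomposition-node : ∀ {h p a aₗ aᵣ bₗ bᵣ cₗ cᵣ} → RootCorrection (2 ^ h) p a aₗ aᵣ →
                     Decomposition h cₗ bₗ a aₗ → Decomposition h cᵣ bᵣ a aᵣ →
                     Decomposition (suc h) (bit a + cₗ + cᵣ) (bit (onBorder p a aₗ aᵣ) + bₗ + bᵣ) p a
decomposition-node {h} {p} {a} {aₗ} {aᵣ} {cₗ = cₗ} {cᵣ} R (Cₗ , balancedₗ) (Cᵣ , balancedᵣ) =
  correction ⊕ Cₗ ⊕ Cᵣ ,
  balance-sum (bit a) cₗ cᵣ (bit (not p ∧ a)) (bit p)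
              (u⁻ correction) (u⁻ Cₗ) (u⁻ Cᵣ) (P⁻ correction) (P⁻ Cₗ) (P⁻ Cᵣ)
              (P⁺ correction) (P⁺ Cₗ) (P⁺ Cᵣ) (u⁺ correction) (u⁺ Cₗ) (u⁺ Cᵣ)
              (bit (not a ∧ aₗ)) (bit (not a ∧ aᵣ))
              (if a ∨ aₗ then 2 ^ h else 0) (if a ∨ aᵣ then 2 ^ h else 0) (if p ∨ a then 2 ^ suc h else 0)
              balancedₗ balancedᵣ unitBalance
              (trans powerBalance (cong (P⁺ correction +_) (if-2^h+2^h (p ∨ a))))
  where
  open RootCorrection R
  if-2^h+2^h : ∀ b → (if b then 2 ^ h + 2 ^ h else 0) ≡ (if b then 2 ^ suc h else 0)
  if-2^h+2^h false = refl
  if-2^h+2^h true  = cong (2 ^ h +_) (sym (+-identityʳ (2 ^ h)))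

decompose : ∀ h t p → Decomposition h (count h t) (borderCount h t p) p (root∈ h t)
decompose zero    t false = noCorrections , refl
decompose zero    t true  = noCorrections , refl
decompose (suc h) t p     =
  decomposition-node (rootCorrection h refl p (t []) (root∈ h (leftSubtree t)) (root∈ h (rightSubtree t)))
                     (decompose h (leftSubtree t) (t []))
                     (decompose h (rightSubtree t) (t []))

transitions-powSum : ∀ {k N} → PowSum k N → transitions N ≤ 2 * k
transitions-powSum {k} {N} ps =
  subst (_≤ 2 * k) (∣-∣-identityʳ (transitions N)) (∣transitions[x+N]-transitions[x]∣≤2k ps 0)

transitions-balance : ∀ {k P} → PowSum k P → ∀ s m z n L → s + m + P ≡ z + n → ∣ m - n ∣ ≤ 2 ^ L →
                      transitions s ≤ transitions z + 2 * k + (L + 2)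
transitions-balance {k} {P} ps s m z n L s+m+P≡z+n ∣m-n∣≤2^L with ≤-total n m
... | inj₁ n≤m = begin
  transitions s
    ≤⟨ ∣m-n∣≤k⇒n≤m+k (transitions (s + c)) (transitions s)
                     (∣transitions[x+c]-transitions[x]∣≤L+2 L s c c≤2^L) ⟩
  transitions (s + c) + (L + 2)
    ≤⟨ +-monoˡ-≤ (L + 2) (∣m-n∣≤k⇒n≤m+k (transitions (s + c + P)) (transitions (s + c))
                                          (∣transitions[x+N]-transitions[x]∣≤2k ps (s + c))) ⟩
  transitions (s + c + P) + 2 * k + (L + 2)
    ≡⟨ cong (λ u → transitions u + 2 * k + (L + 2)) s+c+P≡z ⟩
  transitions z + 2 * k + (L + 2) ∎
  where
  open ≤-Reasoning
  c = m ∸ n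
  c≤2^L : c ≤ 2 ^ L
  c≤2^L = subst (_≤ 2 ^ L) (m≤n⇒∣n-m∣≡n∸m n≤m) ∣m-n∣≤2^L
  s+c+P≡z : s + c + P ≡ z
  s+c+P≡z = +-cancelʳ-≡ n (s + c + P) z (begin-equality
    s + c + P + n    ≡⟨ regroup s c P n ⟩
    s + (n + c) + P  ≡⟨ cong (λ u → s + u + P) (m+[n∸m]≡n n≤m) ⟩
    s + m + P        ≡⟨ s+m+P≡z+n ⟩
    z + n            ∎)
    where
    regroup : ∀ s c P n → s + c + P + n ≡ s + (n + c) + P
    regroup = solve-∀
... | inj₂ m≤n = begin
  transitions s
    ≤⟨ ∣m-n∣≤k⇒n≤m+k (transitions (s + P)) (transitions s) (∣transitions[x+N]-transitions[x]∣≤2k ps s) ⟩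
  transitions (s + P) + 2 * k
    ≡⟨ cong (λ u → transitions u + 2 * k) s+P≡z+c ⟩
  transitions (z + c) + 2 * k
    ≤⟨ +-monoˡ-≤ (2 * k) (∣m-n∣≤k⇒m≤n+k (transitions (z + c)) (transitions z)
                                         (∣transitions[x+c]-transitions[x]∣≤L+2 L z c c≤2^L)) ⟩
  transitions z + (L + 2) + 2 * k
    ≡⟨ xy∙z≈xz∙y (transitions z) (L + 2) (2 * k) ⟩
  transitions z + 2 * k + (L + 2) ∎
  where
  open ≤-Reasoning
  c = n ∸ m
  c≤2^L : c ≤ 2 ^ L
  c≤2^L = subst (_≤ 2 ^ L) (m≤n⇒∣m-n∣≡n∸m m≤n) ∣m-n∣≤2^L
  s+P≡z+c : s + P ≡ z + c
  s+P≡z+c = +-cancelʳ-≡ m (s + P) (z + c) (begin-equality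
    s + P + m    ≡⟨ xy∙z≈xz∙y s P m ⟩
    s + m + P    ≡⟨ s+m+P≡z+n ⟩
    z + n        ≡⟨ cong (z +_) (m+[n∸m]≡n m≤n) ⟨
    z + (m + c)  ≡⟨ x∙yz≈xz∙y z m c ⟩
    z + c + m    ∎)

powSum-if : ∀ {k P} h a → PowSum k P → PowSum (bit a + k) ((if a then 2 ^ h else 0) + P)
powSum-if h false ps = ps
powSum-if h true  ps = h ∷ₚ ps

transitions-decomposition : ∀ {h s b a} → Decomposition h s b false a →
                            ∀ L → suc (2 * b) ≤ 2 ^ L → transitions s ≤ 2 * b + 4 + L
transitions-decomposition {h} {s} {b} {a} (C , balanced) L 1+2b≤2^L = begin
  transitions s
    ≤⟨ transitions-balance (powSum⁻ C) s m z (u⁺ C) L s+m+P⁻≡z+u⁺ ∣m-u⁺∣≤2^L ⟩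
  transitions z + 2 * k⁻ C + (L + 2)
    ≤⟨ +-monoˡ-≤ (L + 2) (+-monoˡ-≤ (2 * k⁻ C) (transitions-powSum (powSum-if h a (powSum⁺ C)))) ⟩
  2 * (bit a + k⁺ C) + 2 * k⁻ C + (L + 2)
    ≡⟨ regroup (bit a) (k⁺ C) (k⁻ C) L ⟩
  2 * bit a + 2 * (k⁺ C + k⁻ C) + (L + 2)
    ≤⟨ +-monoˡ-≤ (L + 2) (+-mono-≤ (*-monoʳ-≤ 2 (bit≤1 a)) (*-monoʳ-≤ 2 (k⁺+k⁻≤b C))) ⟩
  2 + 2 * b + (L + 2)
    ≡⟨ regroup′ b L ⟩
  2 * b + 4 + L ∎
  where
  open ≤-Reasoning
  m = bit a + u⁻ C
  z = (if a then 2 ^ h else 0) + P⁺ C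
  s+m+P⁻≡z+u⁺ : s + m + P⁻ C ≡ z + u⁺ C
  s+m+P⁻≡z+u⁺ = trans (reassociate s (bit a) (u⁻ C) (P⁻ C)) balanced
    where
    reassociate : ∀ s a u P → s + (a + u) + P ≡ s + a + 0 + u + P
    reassociate = solve-∀
  ∣m-u⁺∣≤2^L : ∣ m - u⁺ C ∣ ≤ 2 ^ L
  ∣m-u⁺∣≤2^L = ≤-trans (∣m-n∣≤m⊔n m (u⁺ C))
    (≤-trans (⊔-lub (+-mono-≤ (bit≤1 a) (u⁻≤2b C))
                    (≤-trans (u⁺≤b C) (≤-trans (m≤m+n b (b + 0)) (n≤1+n (2 * b)))))
             1+2b≤2^L)
  regroup : ∀ a p q L → 2 * (a + p) + 2 * q + (L + 2) ≡ 2 * a + 2 * (p + q) + (L + 2)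
  regroup = solve-∀
  regroup′ : ∀ b L → 2 + 2 * b + (L + 2) ≡ 2 * b + 4 + L
  regroup′ = solve-∀

powerOfTwo-bracket : ∀ x → 1 ≤ x → Σ ℕ λ K → 2 ^ K ≤ x × x < 2 ^ suc K
powerOfTwo-bracket (suc zero)    _ = 0 , ≤-refl , s≤s (s≤s z≤n)
powerOfTwo-bracket (suc (suc x)) _ with powerOfTwo-bracket (suc x) (s≤s z≤n)
... | K , 2^K≤1+x , 1+x<2^[1+K] with suc (suc x) <? 2 ^ suc K
...   | yes 2+x<2^[1+K] = K , m≤n⇒m≤1+n 2^K≤1+x , 2+x<2^[1+K]
...   | no  2+x≮2^[1+K] = suc K , ≤-reflexive (sym 2+x≡2^[1+K]) ,
                          subst (_< 2 ^ suc (suc K)) (sym 2+x≡2^[1+K]) (m<m+n (2 ^ suc K) 0<2^[1+K]+0)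
  where
  2+x≡2^[1+K] : suc (suc x) ≡ 2 ^ suc K
  2+x≡2^[1+K] = ≤-antisym 1+x<2^[1+K] (≮⇒≥ 2+x≮2^[1+K])
  0<2^[1+K]+0 : 0 < 2 ^ suc K + 0
  0<2^[1+K]+0 = subst (0 <_) (sym (+-identityʳ _)) (m^n>0 2 (suc K))

≤+⌊log₂3d⌋ : ∀ d b → 1 ≤ d → (∀ L → suc (2 * b) ≤ 2 ^ L → d ≤ 2 * b + 3 + L) →
             d ≤ 2 * b + 3 + ⌊log₂ (3 * d)⌋
≤+⌊log₂3d⌋ d b 1≤d bound with powerOfTwo-bracket (3 * d) (≤-trans 1≤d (m≤n*m d 3))
... | K , 2^K≤3d , 3d<2^[1+K] with suc (2 * b) ≤? 2 ^ K
...   | yes 1+2b≤2^K = ≤-trans (bound K 1+2b≤2^K) (+-monoʳ-≤ (2 * b + 3) K≤log)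
  where
  K≤log : K ≤ ⌊log₂ (3 * d)⌋
  K≤log = subst (_≤ ⌊log₂ (3 * d)⌋) (⌊log₂[2^n]⌋≡n K) (⌊log₂⌋-mono-≤ 2^K≤3d)
...   | no  1+2b≰2^K = ≤-trans (*-cancelˡ-≤ 3 3d≤3[2b+3]) (m≤m+n (2 * b + 3) ⌊log₂ (3 * d)⌋)
  where
  open ≤-Reasoning
  2^K≤2b : 2 ^ K ≤ 2 * b
  2^K≤2b = ≤-pred (≰⇒> 1+2b≰2^K)
  3d≤3[2b+3] : 3 * d ≤ 3 * (2 * b + 3)
  3d≤3[2b+3] = begin
    3 * d             ≤⟨ <⇒≤ 3d<2^[1+K] ⟩
    2 * 2 ^ K         ≤⟨ *-monoʳ-≤ 2 2^K≤2b ⟩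
    2 * (2 * b)       ≤⟨ 4b≤3[2b+3] b ⟩
    3 * (2 * b + 3)   ∎
    where
    4b≤3[2b+3] : ∀ b → 2 * (2 * b) ≤ 3 * (2 * b + 3)
    4b≤3[2b+3] b = subst (2 * (2 * b) ≤_) (6b+9≡ b) (m≤m+n (2 * (2 * b)) (2 * b + 9))
      where
      6b+9≡ : ∀ b → 2 * (2 * b) + (2 * b + 9) ≡ 3 * (2 * b + 3)
      6b+9≡ = solve-∀

-- Sets of every size with a border of half the height

full empty : TreeSet
full  _ = true
empty _ = false

node : Bool → TreeSet → TreeSet → TreeSet
node a l r []          = a
node a l r (left ∷ q)  = l q
node a l r (right ∷ q) = r q

completeSize : ℕ → ℕ
completeSize zero    = 0
completeSize (suc h) = suc (completeSize h + completeSize h)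

count-full : ∀ h → count h full ≡ completeSize h
count-full zero    = refl
count-full (suc h) = cong suc (cong₂ _+_ (count-full h) (count-full h))

borderCount-full : ∀ h p → borderCount h full p ≡ 0
borderCount-full zero    p = refl
borderCount-full (suc h) p = cong₂ _+_ (borderCount-full h true) (borderCount-full h true)

count-empty : ∀ h → count h empty ≡ 0
count-empty zero    = refl
count-empty (suc h) = cong₂ _+_ (count-empty h) (count-empty h)

root∈-empty : ∀ h → root∈ h empty ≡ false
root∈-empty zero    = refl
root∈-empty (suc h) = refl

borderCount-empty : ∀ h → borderCount h empty false ≡ 0
borderCount-empty zero    = refl
borderCount-empty (suc h) rewrite root∈-empty h = cong₂ _+_ (borderCount-empty h) (borderCount-empty h)

record Filling (h s : ℕ) (p : Bool) (k : ℕ) : Set where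
  constructor filling
  field
    set          : TreeSet
    count≡       : count h set ≡ s
    borderCount≤ : borderCount h set p ≤ k


weaken : ∀ {h s p k l} → k ≤ l → Filling h s p k → Filling h s p l
weaken k≤l (filling t c b) = filling t c (≤-trans b k≤l)

fullFilling : ∀ h p → Filling h (completeSize h) p 0
fullFilling h p = filling full (count-full h) (≤-reflexive (borderCount-full h p))

emptyFilling : ∀ h → Filling h 0 false 0
emptyFilling h = filling empty (count-empty h) (≤-reflexive (borderCount-empty h))

node∉[t,∅] : ∀ {h s k} p → Filling h s false k → Filling (suc h) s p (suc k)
node∉[t,∅] {h} {k = k} p (filling t c b) = filling (node false t empty)
  (trans (cong (count h t +_) (count-empty h)) (trans (+-identityʳ (count h t)) c))
  (begin
    r + borderCount h t false + borderCount h empty false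
      ≡⟨ cong (r + borderCount h t false +_) (borderCount-empty h) ⟩
    r + borderCount h t false + 0
      ≡⟨ +-identityʳ _ ⟩
    r + borderCount h t false
      ≤⟨ +-mono-≤ (bit≤1 _) b ⟩
    suc k ∎)
  where
  open ≤-Reasoning
  r = bit (onBorder p false (root∈ h t) (root∈ h empty))

node∉[full,t] : ∀ {h s k} p → Filling h s false k → Filling (suc h) (completeSize h + s) p (suc k)
node∉[full,t] {h} {k = k} p (filling t c b) = filling (node false full t)
  (cong₂ _+_ (count-full h) c)
  (begin
    r + borderCount h full false + borderCount h t false
      ≡⟨ cong (λ n → r + n + borderCount h t false) (borderCount-full h false) ⟩
    r + 0 + borderCount h t false
      ≤⟨ +-mono-≤ (≤-trans (≤-reflexive (+-identityʳ r)) (bit≤1 _)) b ⟩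
    suc k ∎)
  where
  open ≤-Reasoning
  r = bit (onBorder p false (root∈ h full) (root∈ h t))

node∈[full,t] : ∀ {h s k} p → Filling h s true k → Filling (suc h) (suc (completeSize h + s)) p k
node∈[full,t] {h} p (filling t c b) = filling (node true full t)
  (cong suc (cong₂ _+_ (count-full h) c))
  (≤-trans (≤-reflexive (cong (_+ borderCount h t true) (borderCount-full h true))) b)

-- With the root of t and the parent outside as well, the new root is not on the border.
node∉[t∉,∅] : ∀ {h s k} (F : Filling (suc h) s false k) → Filling.set F [] ≡ false → Filling (suc (suc h)) s false k
node∉[t∉,∅] {h} {k = k} (filling t c b) t[]≡false = filling (node false t empty)
  (trans (cong (count (suc h) t +_) (count-empty (suc h))) (trans (+-identityʳ (count (suc h) t)) c))
  (begin
    bit (onBorder false false (t []) false) + borderCount (suc h) t false + borderCount (suc h) empty false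
      ≡⟨ cong₂ (λ a n → bit (onBorder false false a false) + borderCount (suc h) t false + n)
               t[]≡false (borderCount-empty (suc h)) ⟩
    borderCount (suc h) t false + 0
      ≡⟨ +-identityʳ _ ⟩
    borderCount (suc h) t false
      ≤⟨ b ⟩
    k ∎)
  where open ≤-Reasoning

data Cut (a : ℕ) : ℕ → Set where
  below : ∀ {s} → s ≤ a → Cut a s
  above : ∀ s′ → Cut a (suc (a + s′))

cut : ∀ a s → Cut a s
cut zero    zero    = below z≤n
cut zero    (suc s) = above s
cut (suc a) zero    = below z≤n
cut (suc a) (suc s) with cut a s
... | below s≤a = below (s≤s s≤a)
... | above s′  = above s′

a+s≤a⇒s≡0 : ∀ a {s} → a + s ≤ a → s ≡ 0
a+s≤a⇒s≡0 a {s} a+s≤a = n≤0⇒n≡0 (+-cancelˡ-≤ a s 0 (≤-trans a+s≤a (≤-reflexive (sym (+-identityʳ a)))))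

Fillings : ℕ → Bool → (ℕ → ℕ) → Set
Fillings h p k = ∀ s → s ≤ completeSize h → Filling h s p (k h)

fillingInside-step : ∀ h → Fillings h false ⌊_/2⌋ → Fillings h true ⌈_/2⌉ → Fillings (suc h) true ⌈_/2⌉
fillingInside-step h outside inside s s≤ with cut (completeSize h) s
... | below s≤c = node∉[t,∅] true (outside s s≤c)
... | above s′  = weaken (⌈n/2⌉-mono (n≤1+n h))
                        (node∈[full,t] true (inside s′ (+-cancelˡ-≤ (completeSize h) s′ _ (≤-pred s≤))))

fillingOutside-step : ∀ h → Fillings h false ⌊_/2⌋ → Fillings (suc h) true ⌈_/2⌉ →
                      Fillings (suc (suc h)) false ⌊_/2⌋
fillingOutside-step h outside inside s s≤ with cut (completeSize (suc h)) s
... | above s′ = node∈[full,t] false (inside s′ (+-cancelˡ-≤ (completeSize (suc h)) s′ _ (≤-pred s≤)))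
... | below s≤1+2c with cut (completeSize h + completeSize h) s
...   | above s′ with a+s≤a⇒s≡0 (completeSize h + completeSize h) (≤-pred s≤1+2c)
...     | refl = subst (λ n → Filling (suc (suc h)) (suc n) false ⌊ suc (suc h) /2⌋)
                       (sym (+-identityʳ (completeSize h + completeSize h)))
                       (weaken (s≤s z≤n) (node∉[t,∅] false (fullFilling (suc h) false)))
fillingOutside-step h outside inside s s≤ | below s≤1+2c | below s≤2c with cut (completeSize h) s
... | below s≤c = node∉[t∉,∅] (node∉[t,∅] false (outside s s≤c)) refl
... | above s′  = subst (λ n → Filling (suc (suc h)) n false ⌊ suc (suc h) /2⌋) (+-suc c s′)
                        (node∉[t∉,∅] (node∉[full,t] false (outside (suc s′) 1+s′≤c)) refl)
  where
  c = completeSize h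
  1+s′≤c : suc s′ ≤ c
  1+s′≤c = +-cancelˡ-≤ c (suc s′) c (≤-trans (≤-reflexive (+-suc c s′)) s≤2c)

mutual
  fillingOutside : ∀ h → Fillings h false ⌊_/2⌋
  fillingOutside zero          zero          _ = emptyFilling 0
  fillingOutside (suc zero)    zero          _ = emptyFilling 1
  fillingOutside (suc zero)    (suc zero)    _ = fullFilling 1 false
  fillingOutside (suc zero)    (suc (suc s)) (s≤s ())
  fillingOutside (suc (suc h)) = fillingOutside-step h (fillingOutside h) (fillingInside (suc h))

  fillingInside : ∀ h → Fillings h true ⌈_/2⌉
  fillingInside zero    zero _ = filling empty refl z≤n
  fillingInside (suc h) = fillingInside-step h (fillingOutside h) (fillingInside h)

-- Heap numbering: the root is 0 and the children of v are 2v + 1 and 2v + 2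

child : Dir → ℕ → ℕ
child left  v = suc (double v)
child right v = suc (suc (double v))

bitDir : Bool → Dir
bitDir false = left
bitDir true  = right

heapIndex : ℕ → List Dir → ℕ
heapIndex v []      = v
heapIndex v (x ∷ q) = heapIndex (child x v) q

heapTree : (ℕ → Bool) → ℕ → TreeSet
heapTree f v q = f (heapIndex v q)

heapIndex-∷ʳ : ∀ v q x → heapIndex v (q ∷ʳ x) ≡ child x (heapIndex v q)
heapIndex-∷ʳ v []      x = refl
heapIndex-∷ʳ v (y ∷ q) x = heapIndex-∷ʳ (child y v) q x

-- The path to a vertex, read from the vertex up to the root, using fuel k.
pathUpWithin : ℕ → ℕ → List Dir
pathUpWithin zero    _       = []
pathUpWithin (suc k) zero    = []
pathUpWithin (suc k) (suc w) = bitDir (lsb w) ∷ pathUpWithin k ⌊ w /2⌋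

pathUpWithin-heapIndex : ∀ r k → heapIndex 0 (reverse r) ≤ k → pathUpWithin k (heapIndex 0 (reverse r)) ≡ r
pathUpWithin-heapIndex []      zero    _ = refl
pathUpWithin-heapIndex []      (suc k) _ = refl
pathUpWithin-heapIndex (x ∷ r) k       w≤k
  rewrite unfold-reverse x r | heapIndex-∷ʳ 0 (reverse r) x = go x k w≤k
  where
  w = heapIndex 0 (reverse r)
  w≤double : w ≤ double w
  w≤double = ≤-trans (m≤m+n w w) (≤-reflexive (sym (trans (double≡2* w) (cong (w +_) (+-identityʳ w)))))
  go : ∀ x k → child x w ≤ k → pathUpWithin k (child x w) ≡ x ∷ r
  go left  (suc k) (s≤s w≤k) = cong₂ _∷_ (cong bitDir (lsb[bit+double] false w))
    (trans (cong (pathUpWithin k) (⌊bit+double/2⌋≡ false w))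
           (pathUpWithin-heapIndex r k (≤-trans w≤double w≤k)))
  go right (suc k) (s≤s w≤k) = cong₂ _∷_ (cong bitDir (lsb[bit+double] true w))
    (trans (cong (pathUpWithin k) (⌊bit+double/2⌋≡ true w))
           (pathUpWithin-heapIndex r k (≤-trans (≤-trans w≤double (n≤1+n _)) w≤k)))

heapLabelling : TreeSet → ℕ → Bool
heapLabelling t w = t (reverse (pathUpWithin w w))

heapTree-heapLabelling : ∀ t q → heapTree (heapLabelling t) 0 q ≡ t q
heapTree-heapLabelling t q = cong t (begin
  reverse (pathUpWithin w w)
    ≡⟨ cong (λ q′ → reverse (pathUpWithin w (heapIndex 0 q′))) (reverse-involutive q) ⟨
  reverse (pathUpWithin w (heapIndex 0 (reverse (reverse q))))
    ≡⟨ cong reverse (pathUpWithin-heapIndex (reverse q) w (≤-reflexive (cong (heapIndex 0) (reverse-involutive q)))) ⟩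
  reverse (reverse q)
    ≡⟨ reverse-involutive q ⟩
  q ∎)
  where
  open ≡-Reasoning
  w = heapIndex 0 q

root∈-cong : ∀ h {t u} → t ≗ u → root∈ h t ≡ root∈ h u
root∈-cong zero    t≗u = refl
root∈-cong (suc h) t≗u = t≗u []

count-cong : ∀ h {t u} → t ≗ u → count h t ≡ count h u
count-cong zero    t≗u = refl
count-cong (suc h) t≗u = cong₂ _+_ (cong₂ _+_ (cong bit (t≗u [])) (count-cong h (t≗u ∘ (left ∷_))))
                                    (count-cong h (t≗u ∘ (right ∷_)))

borderCount-cong : ∀ h {t u} p → t ≗ u → borderCount h t p ≡ borderCount h u p
borderCount-cong zero    p t≗u = refl
borderCount-cong (suc h) p t≗u rewrite t≗u [] =
  cong₂ _+_ (cong₂ _+_ (cong₂ (λ aₗ aᵣ → bit (onBorder p _ aₗ aᵣ)) (root∈-cong h (t≗u ∘ (left ∷_)))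
                                                                  (root∈-cong h (t≗u ∘ (right ∷_))))
                       (borderCount-cong h _ (t≗u ∘ (left ∷_))))
            (borderCount-cong h _ (t≗u ∘ (right ∷_)))

rangeSum : (ℕ → ℕ) → ℕ → ℕ → ℕ
rangeSum g a zero    = 0
rangeSum g a (suc n) = g a + rangeSum g (suc a) n

rangeSum-+ : ∀ g a m n → rangeSum g a (m + n) ≡ rangeSum g a m + rangeSum g (a + m) n
rangeSum-+ g a zero    n = cong (λ b → rangeSum g b n) (sym (+-identityʳ a))
rangeSum-+ g a (suc m) n = trans (cong (g a +_) (rangeSum-+ g (suc a) m n))
  (trans (sym (+-assoc (g a) _ _)) (cong (λ b → g a + rangeSum g (suc a) m + rangeSum g b n) (sym (+-suc a m))))

rangeSum-suc : ∀ g a n → rangeSum g (suc a) n ≡ rangeSum (g ∘ suc) a n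
rangeSum-suc g a zero    = refl
rangeSum-suc g a (suc n) = cong (g (suc a) +_) (rangeSum-suc g (suc a) n)

rangeSum-0 : ∀ a n → rangeSum (λ _ → 0) a n ≡ 0
rangeSum-0 a zero    = refl
rangeSum-0 a (suc n) = rangeSum-0 (suc a) n

-- The children of a, …, a + n − 1 are 2a + 1, …, 2a + 2n, in order.
rangeSum-children : ∀ f h a n →
  rangeSum (count (suc h) ∘ heapTree f) a n
    ≡ rangeSum (bit ∘ f) a n + rangeSum (count h ∘ heapTree f) (suc (double a)) (double n)
rangeSum-children f h a zero    = refl
rangeSum-children f h a (suc n) =
  trans (cong (count (suc h) (heapTree f a) +_) (rangeSum-children f h (suc a) n))
        (regroup (bit (f a)) (count h (heapTree f (suc (double a)))) (count h (heapTree f (suc (suc (double a)))))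
                 (rangeSum (bit ∘ f) (suc a) n) _)
  where
  regroup : ∀ b l r B R → b + l + r + (B + R) ≡ b + B + (l + (r + R))
  regroup = solve-∀

-- Heap indices a, …, 2a are a full level; their subtrees of height h fill a contiguous range.
rangeSum-level : ∀ f h a → rangeSum (count h ∘ heapTree f) a (suc a) ≡ rangeSum (bit ∘ f) a (suc a * completeSize h)
rangeSum-level f zero    a = trans (rangeSum-0 a (suc a)) (cong (rangeSum (bit ∘ f) a) (sym (*-zeroʳ (suc a))))
rangeSum-level f (suc h) a = begin
  rangeSum (count (suc h) ∘ heapTree f) a (suc a)
    ≡⟨ rangeSum-children f h a (suc a) ⟩
  rangeSum (bit ∘ f) a (suc a) + rangeSum (count h ∘ heapTree f) (suc (double a)) (suc (suc (double a)))
    ≡⟨ cong (rangeSum (bit ∘ f) a (suc a) +_) (rangeSum-level f h (suc (double a))) ⟩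
  rangeSum (bit ∘ f) a (suc a) + rangeSum (bit ∘ f) (suc (double a)) (suc (suc (double a)) * c)
    ≡⟨ cong (λ b → rangeSum (bit ∘ f) a (suc a) + rangeSum (bit ∘ f) b (suc (suc (double a)) * c)) a+1+a≡ ⟩
  rangeSum (bit ∘ f) a (suc a) + rangeSum (bit ∘ f) (a + suc a) (suc (suc (double a)) * c)
    ≡⟨ rangeSum-+ (bit ∘ f) a (suc a) _ ⟨
  rangeSum (bit ∘ f) a (suc a + suc (suc (double a)) * c)
    ≡⟨ cong (rangeSum (bit ∘ f) a) (span (double≡2* a)) ⟩
  rangeSum (bit ∘ f) a (suc a * suc (c + c)) ∎
  where
  open ≡-Reasoning
  c = completeSize h
  a+1+a≡ : suc (double a) ≡ a + suc a
  a+1+a≡ = trans (cong suc (trans (double≡2* a) (cong (a +_) (+-identityʳ a)))) (sym (+-suc a a))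
  span′ : ∀ a c → suc a + suc (suc (2 * a)) * c ≡ suc a * suc (c + c)
  span′ = solve-∀
  span : ∀ {d} → d ≡ 2 * a → suc a + suc (suc d) * c ≡ suc a * suc (c + c)
  span refl = span′ a c

count-heapTree : ∀ f h → count h (heapTree f 0) ≡ rangeSum (bit ∘ f) 0 (completeSize h)
count-heapTree f h =
  trans (sym (+-identityʳ (count h (heapTree f 0))))
        (trans (rangeSum-level f h 0) (cong (rangeSum (bit ∘ f) 0) (+-identityʳ (completeSize h))))

∣tabulate∣≡rangeSum : ∀ n (g : ℕ → Bool) → ∣ tabulate {n = n} (g ∘ toℕ) ∣ ≡ rangeSum (bit ∘ g) 0 n
∣tabulate∣≡rangeSum zero    g = refl
∣tabulate∣≡rangeSum (suc n) g = trans (∣∷∣ (g 0) (tabulate {n = n} (g ∘ suc ∘ toℕ)))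
  (cong (bit (g 0) +_) (trans (∣tabulate∣≡rangeSum n (g ∘ suc)) (sym (rangeSum-suc (bit ∘ g) 0 n))))
  where
  ∣∷∣ : ∀ {n} b (S : Subset n) → ∣ b ∷ᵛ S ∣ ≡ bit b + ∣ S ∣
  ∣∷∣ false S = refl
  ∣∷∣ true  S = refl

child-bitDir : ∀ b y → child (bitDir b) y ≡ suc (bit b + double y)
child-bitDir false y = refl
child-bitDir true  y = refl

parentLabel : (ℕ → Bool) → ℕ → Bool
parentLabel f zero    = false
parentLabel f (suc w) = f ⌊ w /2⌋

parentLabel-child : ∀ f x w → parentLabel f (child x w) ≡ f w
parentLabel-child f left  w = cong f (⌊bit+double/2⌋≡ false w)
parentLabel-child f right w = cong f (⌊bit+double/2⌋≡ true w)

vertexLabel : ℕ → (ℕ → Bool) → ℕ → Bool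
vertexLabel n f c = (c <ᵇ n) ∧ f c

borderLabel : ℕ → (ℕ → Bool) → ℕ → Bool
borderLabel n f w =
  onBorder (parentLabel f w) (f w) (vertexLabel n f (child left w)) (vertexLabel n f (child right w))

T-extensional : ∀ {a b} → (T a → T b) → (T b → T a) → a ≡ b
T-extensional {false} {false} _   _   = refl
T-extensional {false} {true}  _   b⇒a = ⊥-elim (b⇒a tt)
T-extensional {true}  {false} a⇒b _   = ⊥-elim (a⇒b tt)
T-extensional {true}  {true}  _   _   = refl

T-∨⁻ : ∀ a {b} → T (a ∨ b) → T a ⊎ T b
T-∨⁻ a = Equivalence.to (T-∨ {a})

T-∨⁺ˡ : ∀ a {b} → T a → T (a ∨ b)
T-∨⁺ˡ a = Equivalence.from (T-∨ {a}) ∘ inj₁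

T-∨⁺ʳ : ∀ a {b} → T b → T (a ∨ b)
T-∨⁺ʳ a = Equivalence.from (T-∨ {a}) ∘ inj₂

T-∧⁻ : ∀ a {b} → T (a ∧ b) → T a × T b
T-∧⁻ a = Equivalence.to (T-∧ {a})

T-∧⁺ : ∀ a {b} → T a → T b → T (a ∧ b)
T-∧⁺ a Ta Tb = Equivalence.from (T-∧ {a}) (Ta , Tb)

2*i+1≡child-left : ∀ i → 2 * i + 1 ≡ child left i
2*i+1≡child-left i = trans (+-comm (2 * i) 1) (cong suc (sym (double≡2* i)))

2*i+2≡child-right : ∀ i → 2 * i + 2 ≡ child right i
2*i+2≡child-right i = trans (+-comm (2 * i) 2) (cong (suc ∘ suc) (sym (double≡2* i)))

T-isChild⇒ : ∀ i j → T (isChild i j) → ∃ λ x → j ≡ child x i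
T-isChild⇒ i j j~i with T-∨⁻ (j ≡ᵇ 2 * i + 1) j~i
... | inj₁ j≡2i+1 = left  , trans (≡ᵇ⇒≡ j (2 * i + 1) j≡2i+1) (2*i+1≡child-left i)
... | inj₂ j≡2i+2 = right , trans (≡ᵇ⇒≡ j (2 * i + 2) j≡2i+2) (2*i+2≡child-right i)

T-isChild⇐ : ∀ i j x → j ≡ child x i → T (isChild i j)
T-isChild⇐ i j left  j≡ = T-∨⁺ˡ (j ≡ᵇ 2 * i + 1) (≡⇒≡ᵇ j (2 * i + 1) (trans j≡ (sym (2*i+1≡child-left i))))
T-isChild⇐ i j right j≡ = T-∨⁺ʳ (j ≡ᵇ 2 * i + 1) (≡⇒≡ᵇ j (2 * i + 2) (trans j≡ (sym (2*i+2≡child-right i))))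

module _ (d : ℕ) (f : ℕ → Bool) where

  private
    n = cbtSize d
    G = completeBinaryTree d
    S : Subset n
    S = tabulate (f ∘ toℕ)

    member : ∀ u → u ∈ᵇ S ≡ f (toℕ u)
    member = lookup∘tabulate (f ∘ toℕ)

    hasNeighbour : ℕ → Bool
    hasNeighbour w = parentLabel f w ∨ vertexLabel n f (child left w) ∨ vertexLabel n f (child right w)

    neighbour : ∀ {u v} → T (f (toℕ u)) → T (G u v) → T (any (λ u → (u ∈ᵇ S) ∧ G u v) (allFin n))
    neighbour {u} {v} fu u~v = any⁺ (λ u → (u ∈ᵇ S) ∧ G u v)
      (lose (∈-allFin u) (T-∧⁺ (u ∈ᵇ S) (subst T (sym (member u)) fu) u~v))

    childNeighbour : ∀ v x → T (vertexLabel n f (child x (toℕ v))) → T (any (λ u → (u ∈ᵇ S) ∧ G u v) (allFin n))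
    childNeighbour v x c∈ with T-∧⁻ (child x (toℕ v) <ᵇ n) c∈
    ... | c<ᵇn , fc = neighbour {fromℕ< c<n} {v} (subst (T ∘ f) (sym toℕu≡c) fc)
                        (T-∨⁺ʳ (isChild (toℕ u) (toℕ v)) (T-isChild⇐ (toℕ v) (toℕ u) x toℕu≡c))
      where
      c<n = <ᵇ⇒< (child x (toℕ v)) n c<ᵇn
      u = fromℕ< c<n
      toℕu≡c : toℕ u ≡ child x (toℕ v)
      toℕu≡c = toℕ-fromℕ< c<n

    parentNeighbour : ∀ v w → toℕ v ≡ suc w → T (f ⌊ w /2⌋) → T (any (λ u → (u ∈ᵇ S) ∧ G u v) (allFin n))
    parentNeighbour v w v≡1+w fy = neighbour {fromℕ< y<n} {v} (subst (T ∘ f) (sym toℕu≡y) fy)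
      (T-∨⁺ˡ (isChild (toℕ u) (toℕ v)) (T-isChild⇐ (toℕ u) (toℕ v) (bitDir (lsb w)) v≡child))
      where
      y = ⌊ w /2⌋
      y<n : y < n
      y<n = ≤-<-trans (⌊n/2⌋≤n w) (≤-<-trans (n≤1+n w) (subst (_< n) v≡1+w (toℕ<n v)))
      u = fromℕ< y<n
      toℕu≡y : toℕ u ≡ y
      toℕu≡y = toℕ-fromℕ< y<n
      v≡child : toℕ v ≡ child (bitDir (lsb w)) (toℕ u)
      v≡child = trans v≡1+w (trans (cong suc (sym (bit[lsb]+double[⌊/2⌋]≡ w)))
                                   (sym (trans (cong (child (bitDir (lsb w))) toℕu≡y) (child-bitDir (lsb w) y))))

    toAny : ∀ v → T (hasNeighbour (toℕ v)) → T (any (λ u → (u ∈ᵇ S) ∧ G u v) (allFin n))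
    toAny v nb with T-∨⁻ (parentLabel f (toℕ v)) nb
    ... | inj₂ c∈ with T-∨⁻ (vertexLabel n f (child left (toℕ v))) c∈
    ...   | inj₁ l∈ = childNeighbour v left l∈
    ...   | inj₂ r∈ = childNeighbour v right r∈
    toAny v nb | inj₁ p∈ = fromParent (toℕ v) refl p∈
      where
      fromParent : ∀ w → toℕ v ≡ w → T (parentLabel f w) → T (any (λ u → (u ∈ᵇ S) ∧ G u v) (allFin n))
      fromParent (suc w) v≡1+w = parentNeighbour v w v≡1+w

    fromAny : ∀ v → T (any (λ u → (u ∈ᵇ S) ∧ G u v) (allFin n)) → T (hasNeighbour (toℕ v))
    fromAny v nb with satisfied (any⁻ (λ u → (u ∈ᵇ S) ∧ G u v) (allFin n) nb)
    ... | u , u∈S∧u~v with T-∧⁻ (u ∈ᵇ S) u∈S∧u~v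
    ... | u∈S , u~v with T-∨⁻ (isChild (toℕ u) (toℕ v)) u~v
    ...   | inj₁ u-parent with T-isChild⇒ (toℕ u) (toℕ v) u-parent
    ...     | x , v≡child = T-∨⁺ˡ (parentLabel f (toℕ v))
                (subst T (sym (trans (cong (parentLabel f) v≡child) (parentLabel-child f x (toℕ u))))
                           (subst T (member u) u∈S))
    fromAny v nb | u , _ | u∈S , _ | inj₂ u-child with T-isChild⇒ (toℕ v) (toℕ u) u-child
    ... | x , u≡child = inChild x c∈
      where
      c∈ : T (vertexLabel n f (child x (toℕ v)))
      c∈ = T-∧⁺ (child x (toℕ v) <ᵇ n)
             (<⇒<ᵇ (subst (_< n) u≡child (toℕ<n u))) (subst (T ∘ f) u≡child (subst T (member u) u∈S))
      inChild : ∀ x → T (vertexLabel n f (child x (toℕ v))) → T (hasNeighbour (toℕ v))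
      inChild left  l∈ = T-∨⁺ʳ (parentLabel f (toℕ v)) (T-∨⁺ˡ (vertexLabel n f (child left (toℕ v))) l∈)
      inChild right r∈ = T-∨⁺ʳ (parentLabel f (toℕ v)) (T-∨⁺ʳ (vertexLabel n f (child left (toℕ v))) r∈)

  border-tabulate : border G S ≡ tabulate (borderLabel n f ∘ toℕ)
  border-tabulate = tabulate-cong λ v →
    cong₂ (λ a b → not a ∧ b) (member v) (T-extensional (fromAny v) (toAny v))

-- v heads a complete subtree of height h inside the complete binary tree of depth d:
-- v lies on level l = d + 1 − h, i.e. 2 ^ l ≤ v + 1 and v + 2 ≤ 2 ^ (l + 1).
record Position (d h v : ℕ) : Set where
  field
    lower : 2 ^ suc d ≤ suc v * 2 ^ h
    upper : suc (suc v) * 2 ^ h ≤ 2 ^ suc (suc d)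

position-root : ∀ d → Position d (suc d) 0
position-root d = record { lower = ≤-reflexive (sym (*-identityˡ (2 ^ suc d))) ; upper = ≤-refl }

double[m]*P≡m*[2*P] : ∀ m P → double m * P ≡ m * (2 * P)
double[m]*P≡m*[2*P] m P = trans (cong (_* P) (double≡2* m)) (2*m*P≡m*[2*P] m P)
  where
  2*m*P≡m*[2*P] : ∀ m P → 2 * m * P ≡ m * (2 * P)
  2*m*P≡m*[2*P] = solve-∀

-- The children of v, times 2 ^ h, lie between 2 (v + 1) 2 ^ h and 2 (v + 2) 2 ^ h.
position-child : ∀ {d h v} x → Position d (suc h) v → Position d h (child x v)
position-child {d} {h} {v} x pos = record
  { lower = ≤-trans (Position.lower pos)
              (≤-trans (≤-reflexive (sym (double[m]*P≡m*[2*P] (suc v) (2 ^ h))))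
                       (*-monoˡ-≤ (2 ^ h) (s≤s (child-left≤ x))))
  ; upper = ≤-trans (*-monoˡ-≤ (2 ^ h) (s≤s (s≤s (child≤right x))))
              (≤-trans (≤-reflexive (double[m]*P≡m*[2*P] (suc (suc v)) (2 ^ h))) (Position.upper pos))
  }
  where
  child-left≤ : ∀ x → child left v ≤ child x v
  child-left≤ left  = ≤-refl
  child-left≤ right = n≤1+n _
  child≤right : ∀ x → child x v ≤ child right v
  child≤right left  = n≤1+n _
  child≤right right = ≤-refl

position-leaf : ∀ {d c} → Position d 0 c → cbtSize d ≤ c
position-leaf {d} {c} pos = ∸-monoˡ-≤ 1 (≤-trans (Position.lower pos) (≤-reflexive (*-identityʳ (suc c))))

position-inner : ∀ {d h c} → Position d (suc h) c → c < cbtSize d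
position-inner {d} {h} {c} pos = ∸-monoˡ-≤ 1 (begin
  suc (suc c)             ≡⟨ *-identityʳ (suc (suc c)) ⟨
  suc (suc c) * 1         ≤⟨ *-monoʳ-≤ (suc (suc c)) (m^n>0 2 h) ⟩
  suc (suc c) * 2 ^ h     ≤⟨ *-cancelˡ-≤ 2 (≤-trans (≤-reflexive (lemma (suc (suc c)) (2 ^ h))) (Position.upper pos)) ⟩
  2 ^ suc d               ∎)
  where
  open ≤-Reasoning
  lemma : ∀ m P → 2 * (m * P) ≡ m * (2 * P)
  lemma = solve-∀

module _ (d : ℕ) (f : ℕ → Bool) where

  private
    n = cbtSize d

  root∈-heapTree : ∀ {h c} → Position d h c → root∈ h (heapTree f c) ≡ vertexLabel n f c
  root∈-heapTree {zero}  {c} pos =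
    cong (_∧ f c) (T-extensional (λ ()) (λ c<ᵇn → <⇒≱ (<ᵇ⇒< c n c<ᵇn) (position-leaf pos)))
  root∈-heapTree {suc h} {c} pos =
    cong (_∧ f c) (T-extensional (λ _ → <⇒<ᵇ (position-inner pos)) (λ _ → tt))

  borderCount-heapTree : ∀ {h v} → Position d h v →
                         borderCount h (heapTree f v) (parentLabel f v) ≡ count h (heapTree (borderLabel n f) v)
  borderCount-heapTree {zero}      _   = refl
  borderCount-heapTree {suc h} {v} pos = cong₂ _+_ (cong₂ _+_
    (cong₂ (λ aₗ aᵣ → bit (onBorder (parentLabel f v) (f v) aₗ aᵣ))
           (root∈-heapTree (position-child left pos)) (root∈-heapTree (position-child right pos)))
    (subtree left)) (subtree right)
    where
    subtree : ∀ x → borderCount h (heapTree f (child x v)) (f v) ≡ count h (heapTree (borderLabel n f) (child x v))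
    subtree x = trans (cong (borderCount h (heapTree f (child x v))) (sym (parentLabel-child f x v)))
                      (borderCount-heapTree (position-child x pos))

1+completeSize≡2^ : ∀ h → suc (completeSize h) ≡ 2 ^ h
1+completeSize≡2^ zero    = refl
1+completeSize≡2^ (suc h) = begin
  suc (suc (c + c))  ≡⟨ cong suc (+-suc c c) ⟨
  suc c + suc c      ≡⟨ cong₂ _+_ (1+completeSize≡2^ h) (1+completeSize≡2^ h) ⟩
  2 ^ h + 2 ^ h      ≡⟨ cong (2 ^ h +_) (+-identityʳ (2 ^ h)) ⟨
  2 ^ suc h          ∎
  where
  open ≡-Reasoning
  c = completeSize h

completeSize≡2^∸1 : ∀ h → completeSize h ≡ 2 ^ h ∸ 1
completeSize≡2^∸1 h = cong (_∸ 1) (1+completeSize≡2^ h)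

labelOf : ∀ {n} → Subset n → ℕ → Bool
labelOf []ᵛ        _       = false
labelOf (a ∷ᵛ S)   zero    = a
labelOf (a ∷ᵛ S)   (suc w) = labelOf S w

tabulate-labelOf : ∀ {n} (S : Subset n) → tabulate (labelOf S ∘ toℕ) ≡ S
tabulate-labelOf []ᵛ      = refl
tabulate-labelOf (a ∷ᵛ S) = cong (a ∷ᵛ_) (tabulate-labelOf S)

∣tabulate∣≡count : ∀ d (f : ℕ → Bool) → ∣ tabulate {n = cbtSize d} (f ∘ toℕ) ∣ ≡ count (suc d) (heapTree f 0)
∣tabulate∣≡count d f = trans (∣tabulate∣≡rangeSum (cbtSize d) f)
  (trans (cong (rangeSum (bit ∘ f) 0) (sym (completeSize≡2^∸1 (suc d)))) (sym (count-heapTree f (suc d))))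

∣border∣≡borderCount : ∀ d (f : ℕ → Bool) →
  ∣ border (completeBinaryTree d) (tabulate (f ∘ toℕ)) ∣ ≡ borderCount (suc d) (heapTree f 0) false
∣border∣≡borderCount d f = trans (cong ∣_∣ (border-tabulate d f))
  (trans (∣tabulate∣≡count d (borderLabel (cbtSize d) f)) (sym (borderCount-heapTree d f (position-root d))))

minimumOr-≤ : ∀ e {y} xs → y ∈ xs → minimumOr e xs ≤ y
minimumOr-≤ e {y} (x ∷ xs) y∈ = foldr-preservesᵒ {P = _≤ y} ⊓-≤ x xs (from∈ y∈)
  where
  ⊓-≤ : ∀ a b → a ≤ y ⊎ b ≤ y → a ⊓ b ≤ y
  ⊓-≤ a b = [ ≤-trans (m⊓n≤m a b) , ≤-trans (m⊓n≤n a b) ]′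
  from∈ : y ∈ x ∷ xs → x ≤ y ⊎ Any (_≤ y) xs
  from∈ (here y≡x)  = inj₁ (≤-reflexive (sym y≡x))
  from∈ (there y∈xs) = inj₂ (Any.map (≤-reflexive ∘ sym) y∈xs)

minimumOr-∈ : ∀ e {y} xs → y ∈ xs → minimumOr e xs ∈ xs
minimumOr-∈ e (x ∷ xs) _ = [ here , there ]′ (foldr-selective ⊓-sel x xs)

≤-maximum : ∀ {y} xs → y ∈ xs → y ≤ maximum xs
≤-maximum {y} xs y∈ = foldr-preservesᵒ {P = y ≤_} ≤-⊔ 0 xs (inj₂ (Any.map ≤-reflexive y∈))
  where
  ≤-⊔ : ∀ a b → y ≤ a ⊎ y ≤ b → y ≤ a ⊔ b
  ≤-⊔ a b = [ (λ y≤a → ≤-trans y≤a (m≤m⊔n a b)) , (λ y≤b → ≤-trans y≤b (m≤n⊔m a b)) ]′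

maximum-≤ : ∀ {K} xs → All (_≤ K) xs → maximum xs ≤ K
maximum-≤ xs = foldr-preservesᵇ ⊔-lub z≤n

∈-allSubsets : ∀ {n} (S : Subset n) → S ∈ allSubsets n
∈-allSubsets []ᵛ        = here refl
∈-allSubsets (a ∷ᵛ S) =
  ∈-concatMap⁺ (λ S → (true ∷ᵛ S) ∷ (false ∷ᵛ S) ∷ []) (lose (∈-allSubsets S) (here-or-there a))
  where
  here-or-there : ∀ a → (a ∷ᵛ S) ∈ (true ∷ᵛ S) ∷ (false ∷ᵛ S) ∷ []
  here-or-there true  = here refl
  here-or-there false = there (here refl)

module _ {n} (G : Graph n) where

  private
    sizes : ℕ → List (Subset n)
    sizes s = filter (λ S → ∣ S ∣ ≟ s) (allSubsets n)

    ∈-sizes : ∀ (S : Subset n) → S ∈ sizes ∣ S ∣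
    ∈-sizes S = ∈-filter⁺ (λ S → ∣ S ∣ ≟ _) (∈-allSubsets S) refl

  PhiVs≤∣border∣ : ∀ (S : Subset n) → PhiVs G ∣ S ∣ ≤ ∣ border G S ∣
  PhiVs≤∣border∣ S = minimumOr-≤ 0 _ (∈-map⁺ (λ S → ∣ border G S ∣) (∈-sizes S))

  PhiVs-attained : ∀ (S : Subset n) → ∃ λ T → ∣ T ∣ ≡ ∣ S ∣ × PhiVs G ∣ S ∣ ≡ ∣ border G T ∣
  PhiVs-attained S with ∈-map⁻ (λ S → ∣ border G S ∣)
                         (minimumOr-∈ 0 _ (∈-map⁺ (λ S → ∣ border G S ∣) (∈-sizes S)))
  ... | T , T∈ , PhiVs≡ = T , proj₂ (∈-filter⁻ (λ S → ∣ S ∣ ≟ _) {xs = allSubsets n} T∈) , PhiVs≡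

  PhiVs≤PhiV : ∀ s → s ≤ n → PhiVs G s ≤ PhiV G
  PhiVs≤PhiV s s≤n = ≤-maximum _ (∈-map⁺ (PhiVs G) (∈-upTo⁺ (s≤s s≤n)))

  PhiV≤ : ∀ {K} → (∀ s → s ≤ n → PhiVs G s ≤ K) → PhiV G ≤ K
  PhiV≤ {K} bound = maximum-≤ _ (All.tabulate λ y∈ → bounded (∈-map⁻ (PhiVs G) y∈))
    where
    bounded : ∀ {y} → ∃ (λ s → s ∈ upTo (suc n) × y ≡ PhiVs G s) → y ≤ K
    bounded (s , s∈ , refl) = bound s (≤-pred (∈-upTo⁻ s∈))

alternating≤cbtSize : ∀ d → alternating d ≤ cbtSize d
alternating≤cbtSize d = ∸-monoˡ-≤ 1 (alternating<2^[1+d] d)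

module _ (d : ℕ) where

  private
    n = cbtSize d
    G = completeBinaryTree d

  realise : ∀ {s k} → Filling (suc d) s false k → Σ (Subset n) λ S → ∣ S ∣ ≡ s × ∣ border G S ∣ ≤ k
  realise (filling t count≡s borderCount≤k) =
    tabulate (f ∘ toℕ) ,
    trans (∣tabulate∣≡count d f) (trans (count-cong (suc d) (heapTree-heapLabelling t)) count≡s) ,
    ≤-trans (≤-reflexive (trans (∣border∣≡borderCount d f)
                                (borderCount-cong (suc d) false (heapTree-heapLabelling t))))
            borderCount≤k
    where f = heapLabelling t

  subset-with-small-border : ∀ s → s ≤ n → Σ (Subset n) λ S → ∣ S ∣ ≡ s × ∣ border G S ∣ ≤ ⌈ d /2⌉
  subset-with-small-border s s≤n =
    realise (fillingOutside (suc d) s (subst (s ≤_) (sym (completeSize≡2^∸1 (suc d))) s≤n))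

  d≤2∣border∣+3+⌊log₂3d⌋ : 1 ≤ d → ∀ (S : Subset n) → ∣ S ∣ ≡ alternating d →
                            d ≤ 2 * ∣ border G S ∣ + 3 + ⌊log₂ (3 * d)⌋
  d≤2∣border∣+3+⌊log₂3d⌋ 1≤d S ∣S∣≡alt = ≤+⌊log₂3d⌋ d b 1≤d λ L 1+2b≤2^L → ≤-pred (begin
    suc d                        ≡⟨ transitions[alternating] d ⟨
    transitions (alternating d)  ≤⟨ transitions-decomposition D L 1+2b≤2^L ⟩
    2 * b + 4 + L                ≡⟨ cong (_+ L) (+-suc (2 * b) 3) ⟩
    suc (2 * b + 3 + L)          ∎)
    where
    open ≤-Reasoning
    f = labelOf S
    b = ∣ border G S ∣
    count≡ : count (suc d) (heapTree f 0) ≡ alternating d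
    count≡ = trans (sym (∣tabulate∣≡count d f)) (trans (cong ∣_∣ (tabulate-labelOf S)) ∣S∣≡alt)
    borderCount≡ : borderCount (suc d) (heapTree f 0) false ≡ b
    borderCount≡ = trans (sym (∣border∣≡borderCount d f)) (cong (λ S → ∣ border G S ∣) (tabulate-labelOf S))
    D : Decomposition (suc d) (alternating d) b false (f 0)
    D = subst₂ (λ c b → Decomposition (suc d) c b false (f 0)) count≡ borderCount≡
               (decompose (suc d) (heapTree f 0) false)

  PhiVs≤⌈d/2⌉ : ∀ s → s ≤ n → PhiVs G s ≤ ⌈ d /2⌉
  PhiVs≤⌈d/2⌉ s s≤n =
    let S , ∣S∣≡s , ∣∂S∣≤ = subset-with-small-border s s≤n in
    subst (λ s → PhiVs G s ≤ ⌈ d /2⌉) ∣S∣≡s (≤-trans (PhiVs≤∣border∣ G S) ∣∂S∣≤)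

  d≤2PhiVs+3+⌊log₂3d⌋ : 1 ≤ d → d ≤ 2 * PhiVs G (alternating d) + 3 + ⌊log₂ (3 * d)⌋
  d≤2PhiVs+3+⌊log₂3d⌋ 1≤d =
    let S , ∣S∣≡alt , _ = subset-with-small-border (alternating d) (alternating≤cbtSize d)
        T , ∣T∣≡∣S∣ , PhiVs≡∣∂T∣ = PhiVs-attained G S in
    subst (λ s → d ≤ 2 * PhiVs G s + 3 + ⌊log₂ (3 * d)⌋) ∣S∣≡alt
      (subst (λ b → d ≤ 2 * b + 3 + ⌊log₂ (3 * d)⌋) (sym PhiVs≡∣∂T∣)
             (d≤2∣border∣+3+⌊log₂3d⌋ 1≤d T (trans ∣T∣≡∣S∣ ∣S∣≡alt)))

theorem1p6 : (d : ℕ) → 1 ≤ d →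
    (d ≤ 2 * PhiV (completeBinaryTree d) + 3 + ⌊log₂ (3 * d)⌋)
    × (PhiV (completeBinaryTree d) ≤ ⌈ d /2⌉)
theorem1p6 d 1≤d = lower , PhiV≤ G (PhiVs≤⌈d/2⌉ d)
  where
  G = completeBinaryTree d
  lower : d ≤ 2 * PhiV G + 3 + ⌊log₂ (3 * d)⌋
  lower = ≤-trans (d≤2PhiVs+3+⌊log₂3d⌋ d 1≤d)
    (+-monoˡ-≤ ⌊log₂ (3 * d)⌋ (+-monoˡ-≤ 3 (*-monoʳ-≤ 2 (PhiVs≤PhiV G (alternating d) (alternating≤cbtSize d)))))
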